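{- There do not exist primes $p, q$ and positive integers $x, y, z$ such that \[ x^3 - 1 = p^3 y^2 \quad \text{and} \quad x^3 + 1 = q^3 z^2 . \] Equivalently, there are no three consecutive powerful numbers of the form $x^3-1,\ x^3,\ x^3+1$ with $x^3 - 1 = p^3 y^2$ and $x^3+1 = q^3 z^2$ for primes $p,q$ and positive integers $x,y,z$.
   Context: A positive integer $n$ is called powerful if $p^2 \mid n$ for every prime $p$ dividing $n$. -}

module Defs where

{-# OPTIONS --safe #-}
-- Put x = m + 1 and Φ₃ n = n² + n + 1, so that x³ − 1 = m Φ₃(m + 1) and x³ + 1 = (m + 2) Φ₃(m).
-- If a and b are coprime and a b = r³ w² with r prime, then a or b is a square: if r ∤ a,
-- then a is coprime to r b and a (r b) = (r² w)².  Non-squares are detected by residues mod 3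
-- or by lying strictly between consecutive squares, as Φ₃ n does for n ≥ 1.
-- If 3 ∣ m, the factors m + 2 and Φ₃ m of x³ + 1 are coprime (their gcd divides 3), but
-- m + 2 ≡ 2 (mod 3) and Φ₃ m are non-squares.  Otherwise m and Φ₃(m + 1) are coprime, so
-- m = s² and x³ + 1 = (s² + 2) Φ₃(s − 1) Φ₃(s).  The coprime Φ₃(s − 1), Φ₃(s) are not both
-- divisible by 3; the one that is not is coprime to the other two factors, and neither it nor
-- the product of the other two is a square (four times that product lies strictly between
-- consecutive squares).
module Submission where

open import Defs
open import Data.Nat using (ℕ; _+_; _*_; _^_; _>_)
open import Data.Nat.Primality using (Prime)
open import Data.Product using (∃-syntax; _×_)
open import Relation.Nullary using (¬_)
open import Relation.Binary.PropositionalEquality using (_≡_)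

open import Data.Empty using (⊥-elim)
open import Data.List using (_∷_; [])
open import Data.Nat using (zero; suc; pred; _<_; _≤?_; z≤n; s≤s; z<s; NonZero; ≢-nonZero; nonTrivial⇒n>1; nonTrivial⇒≢1; _%_)
open import Data.Nat.Coprimality using (Coprime; coprime-divisor; coprime-/gcd) renaming (sym to coprime-sym)
open import Data.Nat.Divisibility
open import Data.Nat.DivMod using ([m+kn]%n≡m%n; %-distribˡ-*; m%n<n)
open import Data.Nat.GCD using (gcd; gcd[m,n]∣m; gcd[m,n]∣n; gcd[m,n]≢0; module Bézout)
open import Data.Nat.Primality using (prime⇒irreducible; prime⇒nonTrivial; prime[2]; prime?)
open import Data.Nat.Properties
open import Data.Nat.Tactic.RingSolver using (solve-∀; solve)
open import Data.Product using (_,_)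
open import Data.Sum using (_⊎_; inj₁; inj₂; [_,_]′; fromInj₁)
open import Function using (_∘_)
open import Relation.Nullary using (yes; no; contradiction)
open import Relation.Nullary.Decidable using (from-yes)
open import Relation.Binary.PropositionalEquality using (_≢_; refl; sym; trans; cong; subst; subst₂; module ≡-Reasoning)

IsSquare : ℕ → Set
IsSquare n = ∃[ a ] n ≡ a * a

Φ₃ : ℕ → ℕ
Φ₃ n = n * n + n + 1
-- Inlined so that the ring solver sees the polynomial behind Φ₃.
{-# INLINE Φ₃ #-}

prime[3] : Prime 3
prime[3] = from-yes (prime? 3)

coprime-* : ∀ {m n o} → Coprime m n → Coprime m o → Coprime m (n * o)
coprime-* m⊥n m⊥o (d∣m , d∣no) =
  m⊥o (d∣m , coprime-divisor (λ (e∣d , e∣n) → m⊥n (∣-trans e∣d d∣m , e∣n)) d∣no)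

prime∤⇒coprime : ∀ {p n} → Prime p → ¬ p ∣ n → Coprime p n
prime∤⇒coprime p-prime p∤n (d∣p , d∣n) with prime⇒irreducible p-prime d∣p
... | inj₁ d≡1  = d≡1
... | inj₂ refl = contradiction d∣n p∤n

∣m+n∣n⇒∣m : ∀ {d m n} → d ∣ m + n → d ∣ n → d ∣ m
∣m+n∣n⇒∣m {d} {m} {n} d∣m+n = ∣m+n∣m⇒∣n (subst (d ∣_) (+-comm m n) d∣m+n)

Bézout⇒coprime : ∀ {c m n} → Coprime c m → Bézout.Identity c m n → Coprime m n
Bézout⇒coprime {c} {m} {n} c⊥m identity {d} (d∣m , d∣n) = c⊥m (d∣c identity , d∣m)
  where
  d∣c : Bézout.Identity c m n → d ∣ c
  d∣c (Bézout.+- x y c+yn≡xm) =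
    ∣m+n∣n⇒∣m (subst (d ∣_) (sym c+yn≡xm) (∣n⇒∣m*n x d∣m)) (∣n⇒∣m*n y d∣n)
  d∣c (Bézout.-+ x y c+xm≡yn) =
    ∣m+n∣n⇒∣m (subst (d ∣_) (sym c+xm≡yn) (∣n⇒∣m*n y d∣n)) (∣n⇒∣m*n x d∣m)

cofactor-square : ∀ {m n w g m₁ w₁} .{{_ : NonZero g}} → m ≡ m₁ * g → w ≡ w₁ * g →
                  Coprime m₁ w₁ → Coprime m n → m * n ≡ w * w → m ≡ g * g
cofactor-square {n = n} {g = g} {m₁} {w₁} refl refl m₁⊥w₁ m⊥n mn≡ww =
  cong (_* g) (∣-antisym m₁∣g g∣m₁)
  where
  open ≡-Reasoning
  m₁n≡w₁w₁g : m₁ * n ≡ w₁ * (w₁ * g)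
  m₁n≡w₁w₁g = *-cancelʳ-≡ _ _ g (begin
    m₁ * n * g          ≡⟨ solve (m₁ ∷ n ∷ g ∷ []) ⟩
    m₁ * g * n          ≡⟨ mn≡ww ⟩
    w₁ * g * (w₁ * g)   ≡⟨ solve (w₁ ∷ g ∷ []) ⟩
    w₁ * (w₁ * g) * g   ∎)
  m₁∣g : m₁ ∣ g
  m₁∣g = coprime-divisor m₁⊥w₁ (coprime-divisor m₁⊥w₁
           (divides n (trans (sym m₁n≡w₁w₁g) (*-comm m₁ n))))
  g⊥n : Coprime g n
  g⊥n (d∣g , d∣n) = m⊥n (∣n⇒∣m*n m₁ d∣g , d∣n)
  g∣m₁ : g ∣ m₁
  g∣m₁ = coprime-divisor g⊥n
           (divides (w₁ * w₁) (trans (*-comm n m₁) (trans m₁n≡w₁w₁g (sym (*-assoc w₁ w₁ g)))))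

coprime-square-factor : ∀ {m n w} → Coprime m n → m * n ≡ w * w → IsSquare m
coprime-square-factor {zero}      _   _     = 0 , refl
coprime-square-factor {m@(suc _)} {w = w} m⊥n mn≡ww =
  g , cofactor-square (m∣n⇒n≡quotient*m g∣m) (m∣n⇒n≡quotient*m g∣w) m₁⊥w₁ m⊥n mn≡ww
  where
  g = gcd m w
  instance
    g≢0 : NonZero g
    g≢0 = ≢-nonZero (gcd[m,n]≢0 m w (inj₁ λ ()))
  g∣m = gcd[m,n]∣m m w
  g∣w = gcd[m,n]∣n m w
  m₁⊥w₁ : Coprime (quotient g∣m) (quotient g∣w)
  m₁⊥w₁ = subst₂ Coprime (n/m≡quotient g∣m) (n/m≡quotient g∣w) (coprime-/gcd m w)

coprime-square-factor-of-p³w² : ∀ {r m n} w → Prime r → ¬ r ∣ m → Coprime m n →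
                                 m * n ≡ r ^ 3 * w ^ 2 → IsSquare m
coprime-square-factor-of-p³w² {r} {m} {n} w r-prime r∤m m⊥n mn≡r³w² =
  coprime-square-factor {w = r * (r * w)} m⊥rn (begin
    m * (r * n)                              ≡⟨ solve (m ∷ r ∷ n ∷ []) ⟩
    r * (m * n)                              ≡⟨ cong (r *_) mn≡r³w² ⟩
    r * (r * (r * (r * 1)) * (w * (w * 1)))  ≡⟨ solve (r ∷ w ∷ []) ⟩
    r * (r * w) * (r * (r * w))              ∎)
  where
  open ≡-Reasoning
  m⊥rn : Coprime m (r * n)
  m⊥rn = coprime-* (coprime-sym (prime∤⇒coprime r-prime r∤m)) m⊥n

coprime-p³w²-factors : ∀ {r m n} w → Prime r → Coprime m n → m * n ≡ r ^ 3 * w ^ 2 →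
                       IsSquare m ⊎ IsSquare n
coprime-p³w²-factors {r} {m} {n} w r-prime m⊥n mn≡r³w² with r ∣? m | r ∣? n
... | no r∤m  | _       = inj₁ (coprime-square-factor-of-p³w² w r-prime r∤m m⊥n mn≡r³w²)
... | _       | no r∤n  = inj₂ (coprime-square-factor-of-p³w² w r-prime r∤n (coprime-sym m⊥n)
                                                                 (trans (*-comm n m) mn≡r³w²))
... | yes r∣m | yes r∣n =
  contradiction (m⊥n (r∣m , r∣n)) (nonTrivial⇒≢1 {{prime⇒nonTrivial r-prime}})

0<n<8⇒n≢p³*w : ∀ {p n} w → Prime p → .{{NonZero n}} → n < 8 → n ≢ p ^ 3 * w
0<n<8⇒n≢p³*w {p} w p-prime n<8 n≡p³w = <⇒≱ n<8 (begin
  8      ≤⟨ ^-monoˡ-≤ 3 (nonTrivial⇒n>1 p {{prime⇒nonTrivial p-prime}}) ⟩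
  p ^ 3  ≤⟨ ∣⇒≤ (divides w (trans n≡p³w (*-comm (p ^ 3) w))) ⟩
  _      ∎)
  where open ≤-Reasoning

m+1+k≡n⇒m<n : ∀ {m n} k → m + suc k ≡ n → m < n
m+1+k≡n⇒m<n {m} k refl = m<m+n m z<s

between-squares⇒¬square : ∀ n {m} → n * n < m → m < suc n * suc n → ¬ IsSquare m
between-squares⇒¬square n n²<m m<[1+n]² (a , refl) with a ≤? n
... | yes a≤n = <⇒≱ n²<m (*-mono-≤ a≤n a≤n)
... | no  a≰n = <⇒≱ m<[1+n]² (*-mono-≤ (≰⇒> a≰n) (≰⇒> a≰n))

4*-square : ∀ {m} → IsSquare m → IsSquare (4 * m)
4*-square (a , refl) = 2 * a , solve (a ∷ [])

square%3≢2 : ∀ a → a * a % 3 ≢ 2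
square%3≢2 a a²%3≡2 with a % 3 | m%n<n a 3 | trans (sym (%-distribˡ-* a a 3)) a²%3≡2
... | 0 | _ | ()
... | 1 | _ | ()
... | 2 | _ | ()
... | suc (suc (suc _)) | s≤s (s≤s (s≤s ())) | _

[3j+2]%3≡2 : ∀ j → (j * 3 + 2) % 3 ≡ 2
[3j+2]%3≡2 j = trans (cong (_% 3) (+-comm (j * 3) 2)) ([m+kn]%n≡m%n 2 j 3)

¬square-3j+2 : ∀ j → ¬ IsSquare (j * 3 + 2)
¬square-3j+2 j (a , eq) = square%3≢2 a (trans (cong (_% 3) (sym eq)) ([3j+2]%3≡2 j))

3∤3j+2 : ∀ j → ¬ 3 ∣ j * 3 + 2
3∤3j+2 j 3∣ = contradiction (trans (sym ([3j+2]%3≡2 j)) (n∣m⇒m%n≡0 _ 3 3∣)) λ ()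

Φ₃-suc : ∀ k → Φ₃ (suc k) ≡ suc k * 2 + Φ₃ k
Φ₃-suc = solve-∀

Φ₃-odd : ∀ k → ¬ 2 ∣ Φ₃ k
Φ₃-odd zero    2∣1       = contradiction (∣1⇒≡1 2∣1) λ ()
Φ₃-odd (suc k) 2∣Φ₃[1+k] =
  Φ₃-odd k (∣m+n∣m⇒∣n (subst (2 ∣_) (Φ₃-suc k) 2∣Φ₃[1+k]) (n∣m*n (suc k)))

Φ₃-consecutive-coprime : ∀ k → Coprime (Φ₃ k) (Φ₃ (suc k))
Φ₃-consecutive-coprime k =
  Bézout⇒coprime (prime∤⇒coprime prime[2] (Φ₃-odd k)) (Bézout.+- (k + 2) k identity)
  where
  identity : 2 + k * Φ₃ (suc k) ≡ (k + 2) * Φ₃ k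
  identity = solve (k ∷ [])

¬square-Φ₃ : ∀ n → ¬ IsSquare (Φ₃ (suc n))
¬square-Φ₃ n = between-squares⇒¬square (suc n) (m+1+k≡n⇒m<n _ lower) (m+1+k≡n⇒m<n _ upper)
  where
  lower : suc n * suc n + suc (suc n) ≡ Φ₃ (suc n)
  lower = solve (n ∷ [])
  upper : Φ₃ (suc n) + suc n ≡ suc (suc n) * suc (suc n)
  upper = solve (n ∷ [])

¬square-[s²+2]Φ₃[s] : ∀ {s} → 1 < s → ¬ IsSquare ((s * s + 2) * Φ₃ s)
¬square-[s²+2]Φ₃[s] {s@(suc (suc j))} (s≤s (s≤s z≤n)) =
  between-squares⇒¬square (2 * s * s + s + 2) (m+1+k≡n⇒m<n _ lower) (m+1+k≡n⇒m<n _ upper)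
  ∘ 4*-square
  where
  lower : (2 * s * s + s + 2) * (2 * s * s + s + 2) + suc (3 * s * s + 4 * s + 3)
          ≡ 4 * ((s * s + 2) * Φ₃ s)
  lower = solve (j ∷ [])
  upper : 4 * ((s * s + 2) * Φ₃ s) + suc (j * j + 2 * j)
          ≡ suc (2 * s * s + s + 2) * suc (2 * s * s + s + 2)
  upper = solve (j ∷ [])

¬square-[s²+2]Φ₃[s-1] : ∀ {s} → 0 < s → ¬ IsSquare ((s * s + 2) * Φ₃ (pred s))
¬square-[s²+2]Φ₃[s-1] {s@(suc k)} (s≤s z≤n) =
  between-squares⇒¬square (2 * k * k + 3 * k + 3) (m+1+k≡n⇒m<n _ lower) (m+1+k≡n⇒m<n _ upper)
  ∘ 4*-square
  where
  lower : (2 * k * k + 3 * k + 3) * (2 * k * k + 3 * k + 3) + suc (3 * k * k + 2 * k + 2)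
          ≡ 4 * ((s * s + 2) * Φ₃ k)
  lower = solve (k ∷ [])
  upper : 4 * ((s * s + 2) * Φ₃ k) + suc (k * k + 4 * k + 3)
          ≡ suc (2 * k * k + 3 * k + 3) * suc (2 * k * k + 3 * k + 3)
  upper = solve (k ∷ [])

cube∸1 : ∀ m → suc m ^ 3 ≡ m * Φ₃ (suc m) + 1
cube∸1 m = begin
  suc m ^ 3                      ≡⟨⟩
  suc m * (suc m * (suc m * 1))  ≡⟨ solve (m ∷ []) ⟩
  m * Φ₃ (suc m) + 1             ∎
  where open ≡-Reasoning

cube+1 : ∀ m → suc m ^ 3 + 1 ≡ (m + 2) * Φ₃ m
cube+1 m = begin
  suc m ^ 3 + 1                      ≡⟨⟩
  suc m * (suc m * (suc m * 1)) + 1  ≡⟨ solve (m ∷ []) ⟩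
  (m + 2) * Φ₃ m                     ∎
  where open ≡-Reasoning

[3j+2]Φ₃[3j]≢q³z² : ∀ {q} z j → Prime q → (j * 3 + 2) * Φ₃ (j * 3) ≢ q ^ 3 * z ^ 2
[3j+2]Φ₃[3j]≢q³z² z zero    q-prime = 0<n<8⇒n≢p³*w (z ^ 2) q-prime (s≤s (s≤s (s≤s z≤n)))
[3j+2]Φ₃[3j]≢q³z² z (suc i) q-prime eq =
  [ ¬square-3j+2 (suc i) , ¬square-Φ₃ (2 + i * 3) ]′ (coprime-p³w²-factors z q-prime coprime eq)
  where
  identity : 3 + (2 + i * 3) * (suc i * 3 + 2) ≡ 1 * Φ₃ (suc i * 3)
  identity = solve (i ∷ [])
  coprime : Coprime (suc i * 3 + 2) (Φ₃ (suc i * 3))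
  coprime = Bézout⇒coprime (prime∤⇒coprime prime[3] (3∤3j+2 (suc i)))
                           (Bézout.-+ (2 + i * 3) 1 identity)

mΦ₃[1+m]≡p³y²⇒square : ∀ {p} y m → Prime p → ¬ 3 ∣ m →
                        m * Φ₃ (suc m) ≡ p ^ 3 * y ^ 2 → IsSquare m
mΦ₃[1+m]≡p³y²⇒square y m p-prime 3∤m eq =
  fromInj₁ (⊥-elim ∘ ¬square-Φ₃ m) (coprime-p³w²-factors y p-prime coprime eq)
  where
  identity : 3 + (m + 3) * m ≡ 1 * Φ₃ (suc m)
  identity = solve (m ∷ [])
  coprime : Coprime m (Φ₃ (suc m))
  coprime = Bézout⇒coprime (prime∤⇒coprime prime[3] 3∤m) (Bézout.-+ (m + 3) 1 identity)

3∤Φ₃[s-1]⇒[s²+2]Φ₃[s²]≢q³z² : ∀ {q s} z → Prime q → 1 < s → ¬ 3 ∣ Φ₃ (pred s) →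
                                (s * s + 2) * Φ₃ (s * s) ≢ q ^ 3 * z ^ 2
3∤Φ₃[s-1]⇒[s²+2]Φ₃[s²]≢q³z² {s = s@(suc (suc j))} z q-prime 1<s@(s≤s (s≤s z≤n))
                            3∤Φ₃[s-1] eq =
  [ ¬square-Φ₃ j , ¬square-[s²+2]Φ₃[s] 1<s ]′
    (coprime-p³w²-factors z q-prime (coprime-* coprime (Φ₃-consecutive-coprime (suc j)))
                                    (trans factorisation eq))
  where
  factorisation : Φ₃ (suc j) * ((s * s + 2) * Φ₃ s) ≡ (s * s + 2) * Φ₃ (s * s)
  factorisation = solve (j ∷ [])
  identity : 3 + j * (s * s + 2) ≡ suc j * Φ₃ (suc j)
  identity = solve (j ∷ [])
  coprime : Coprime (Φ₃ (suc j)) (s * s + 2)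
  coprime = Bézout⇒coprime (prime∤⇒coprime prime[3] 3∤Φ₃[s-1]) (Bézout.+- (suc j) j identity)

3∣Φ₃[s-1]⇒[s²+2]Φ₃[s²]≢q³z² : ∀ {q s} z → Prime q → 0 < s → 3 ∣ Φ₃ (pred s) →
                                (s * s + 2) * Φ₃ (s * s) ≢ q ^ 3 * z ^ 2
3∣Φ₃[s-1]⇒[s²+2]Φ₃[s²]≢q³z² {s = s@(suc k)} z q-prime 0<s@(s≤s z≤n) 3∣Φ₃[s-1] eq =
  [ ¬square-Φ₃ k , ¬square-[s²+2]Φ₃[s-1] 0<s ]′
    (coprime-p³w²-factors z q-prime (coprime-* coprime (coprime-sym (Φ₃-consecutive-coprime k)))
                                    (trans factorisation eq))
  where
  factorisation : Φ₃ s * ((s * s + 2) * Φ₃ k) ≡ (s * s + 2) * Φ₃ (s * s)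
  factorisation = solve (k ∷ [])
  3∤Φ₃s : ¬ 3 ∣ Φ₃ s
  3∤Φ₃s 3∣Φ₃s = contradiction (Φ₃-consecutive-coprime k (3∣Φ₃[s-1] , 3∣Φ₃s)) λ ()
  identity : 3 + (k + 2) * Φ₃ s ≡ (k + 3) * (s * s + 2)
  identity = solve (k ∷ [])
  coprime : Coprime (Φ₃ s) (s * s + 2)
  coprime = Bézout⇒coprime (prime∤⇒coprime prime[3] 3∤Φ₃s) (Bézout.-+ (k + 2) (k + 3) identity)

[s²+2]Φ₃[s²]≢q³z² : ∀ {q s} z → Prime q → 1 < s → (s * s + 2) * Φ₃ (s * s) ≢ q ^ 3 * z ^ 2
[s²+2]Φ₃[s²]≢q³z² {s = suc k} z q-prime 1<s with 3 ∣? Φ₃ k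
... | no  3∤Φ₃k = 3∤Φ₃[s-1]⇒[s²+2]Φ₃[s²]≢q³z² z q-prime 1<s 3∤Φ₃k
... | yes 3∣Φ₃k = 3∣Φ₃[s-1]⇒[s²+2]Φ₃[s²]≢q³z² {s = suc k} z q-prime (s≤s z≤n) 3∣Φ₃k

mΦ₃[1+m]≡p³y²⇒[m+2]Φ₃[m]≢q³z² : ∀ {p q} m y z → Prime p → Prime q →
              m * Φ₃ (suc m) ≡ p ^ 3 * y ^ 2 → (m + 2) * Φ₃ m ≢ q ^ 3 * z ^ 2
mΦ₃[1+m]≡p³y²⇒[m+2]Φ₃[m]≢q³z² m y z p-prime q-prime x³-1≡p³y² with 3 ∣? m
... | yes (divides-refl j) = [3j+2]Φ₃[3j]≢q³z² z j q-prime
... | no 3∤m with mΦ₃[1+m]≡p³y²⇒square y m p-prime 3∤m x³-1≡p³y²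
...   | zero , refl              = contradiction (3 ∣0) 3∤m
...   | suc zero , refl          = contradiction x³-1≡p³y² (0<n<8⇒n≢p³*w (y ^ 2) p-prime ≤-refl)
...   | suc (suc _) , refl       = [s²+2]Φ₃[s²]≢q³z² z q-prime (s≤s (s≤s z≤n))

theorem1 : ¬ (∃[ p ] ∃[ q ] ∃[ x ] ∃[ y ] ∃[ z ]
               (Prime p × Prime q × x > 0 × y > 0 × z > 0
                × x ^ 3 ≡ p ^ 3 * y ^ 2 + 1
                × x ^ 3 + 1 ≡ q ^ 3 * z ^ 2))
theorem1 (_ , _ , zero , _ , _ , _ , _ , () , _)
theorem1 (_ , _ , suc m , y , z , p-prime , q-prime , _ , _ , _ , x³≡p³y²+1 , x³+1≡q³z²) =
  mΦ₃[1+m]≡p³y²⇒[m+2]Φ₃[m]≢q³z² m y z p-prime q-prime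
    (+-cancelʳ-≡ 1 _ _ (trans (sym (cube∸1 m)) x³≡p³y²+1))
    (trans (sym (cube+1 m)) x³+1≡q³z²)
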